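{- Let $h(x)$ be a polynomial with real coefficients and for $n\ge1$, $0\le l\le\lfloor n/2\rfloor$ let $L_{h,n}^l(x)=\sum_{i=0}^{l}\frac{n}{n-i}\binom{n-i}{i}h^{n-2i}(x)$. Then for all integers $s\ge0$, $n\ge1$ and $l$ with $0\le l\le\frac{n-s}{2}$, $$\sum_{i=0}^{s}\binom{s}{i}L_{h,n+i}^{l+i}(x)\,h^{i}(x)=L_{h,n+2s}^{l+s}(x).$$
   Context: $h(x)$ is a polynomial with real coefficients; $h^k(x)$ denotes $(h(x))^k$. $L_{h,n}^l$ are the incomplete $h(x)$-Lucas polynomials. -}

module Defs where

open import Level using (Level)
open import Data.Nat as ℕ using (ℕ; zero; suc; _∸_)
open import Data.Nat.DivMod using (_/_)
open import Data.Nat.Combinatorics using (_C_)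
open import Algebra.Bundles using (CommutativeRing; Semiring)
import Algebra.Definitions.RawSemiring as RS

-- exact natural division a / b, with the (never used) convention a / 0 = 0
_div_ : ℕ → ℕ → ℕ
a div zero = 0
a div suc k = a / suc k

-- the Lucas coefficient n/(n-i) * binom(n-i, i), computed as (n * binom(n-i,i)) / (n-i)
lucasCoeff : ℕ → ℕ → ℕ
lucasCoeff n i = (n ℕ.* ((n ∸ i) C i)) div (n ∸ i)

module _ {c ℓ : Level} (R : CommutativeRing c ℓ) where
  open CommutativeRing R
  open RS (Semiring.rawSemiring semiring) using (_×_; _^_)

  nmul : ℕ → Carrier → Carrier
  nmul k a = k × a

  pow : Carrier → ℕ → Carrier
  pow a k = a ^ k

  sumTo : ℕ → (ℕ → Carrier) → Carrier
  sumTo zero    f = f 0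
  sumTo (suc m) f = sumTo m f + f (suc m)

  incLucas : Carrier → ℕ → ℕ → Carrier
  incLucas h n l = sumTo l (λ i → lucasCoeff n i × (h ^ (n ∸ 2 ℕ.* i)))

{-# OPTIONS --safe #-}
-- Splitting n/(n-i) C(n-i,i) = C(n-i,i) + C(n-i-1,i-1), Pascal's rule gives the
-- recurrence L_{h,n+2}^{l+1} = h L_{h,n+1}^{l+1} + L_{h,n}^{l} as long as 2l < n. On the other side,
-- Pascal's rule for C(s+1,i) gives B_{s+1}(a) = B_s(a) + h B_s(a ∘ suc) for the binomial sums
-- B_s(a) = Σ_i C(s,i) a_i h^i. Induction on s with a_i = L_{h,n+i}^{l+i} then reduces the claim
-- to the recurrence.
module Submission where

open import Defs
open import Level using (Level)
open import Data.Nat as ℕ using (ℕ; zero; suc; _≤_; _<_; _∸_)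
open import Data.Nat.Combinatorics using (_C_)
open import Algebra.Bundles using (CommutativeRing)

module LucasCoefficients where

  open import Data.Nat
  open import Data.Nat.Properties
  open import Data.Nat.DivMod using (_/_; m*n/n≡m)
  open import Data.Nat.Combinatorics using (nC1≡n; nCk+nC[k+1]≡[n+1]C[k+1])
  open import Data.Nat.Tactic.RingSolver using (solve-∀)
  open import Relation.Binary.PropositionalEquality
  open ≡-Reasoning

  -- n/(n-i) C(n-i,i) = C(n-i,i) + C(n-i-1,i-1), where the second term is absent for i = 0
  lucasBinom : ℕ → ℕ → ℕ
  lucasBinom n zero    = 1
  lucasBinom n (suc i) = (n ∸ suc i) C suc i + (n ∸ suc (suc i)) C i

  [1+j]*[1+k]C[1+j]≡[1+k]*kCj : ∀ k j → suc j * (suc k C suc j) ≡ suc k * (k C j)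
  [1+j]*[1+k]C[1+j]≡[1+k]*kCj zero    zero    = refl
  [1+j]*[1+k]C[1+j]≡[1+k]*kCj zero    (suc j) = *-zeroʳ (2 + j)
  [1+j]*[1+k]C[1+j]≡[1+k]*kCj (suc k) zero    = trans (+-identityʳ _) (trans (nC1≡n (2 + k)) (sym (*-identityʳ (2 + k))))
  [1+j]*[1+k]C[1+j]≡[1+k]*kCj (suc k) (suc j) = begin
      (2 + j) * ((2 + k) C (2 + j))
        ≡⟨ cong ((2 + j) *_) (nCk+nC[k+1]≡[n+1]C[k+1] (suc k) (suc j)) ⟨
      (2 + j) * (a + b)
        ≡⟨ rearrange₁ j a b ⟩
      suc j * a + a + (2 + j) * b
        ≡⟨ cong₂ (λ x y → x + a + y) ([1+j]*[1+k]C[1+j]≡[1+k]*kCj k j) ([1+j]*[1+k]C[1+j]≡[1+k]*kCj k (suc j)) ⟩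
      suc k * (k C j) + a + suc k * (k C suc j)
        ≡⟨ rearrange₂ k a (k C j) (k C suc j) ⟩
      suc k * (k C j + k C suc j) + a
        ≡⟨ cong (λ x → suc k * x + a) (nCk+nC[k+1]≡[n+1]C[k+1] k j) ⟩
      suc k * a + a
        ≡⟨ +-comm (suc k * a) a ⟩
      (2 + k) * a ∎
    where
      a = suc k C suc j
      b = suc k C (2 + j)
      rearrange₁ : ∀ j a b → (2 + j) * (a + b) ≡ suc j * a + a + (2 + j) * b
      rearrange₁ = solve-∀
      rearrange₂ : ∀ k a c d → suc k * c + a + suc k * d ≡ suc k * (c + d) + a
      rearrange₂ = solve-∀

  lucasBinom-+ : ∀ m j → lucasBinom (suc m + suc j) (suc j) ≡ suc m C suc j + m C j
  lucasBinom-+ m j = cong₂ (λ a b → a C suc j + b C j) (m+n∸n≡m (suc m) (suc j)) (m+n∸n≡m m (suc j))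

  *-lucasBinom : ∀ k i → (suc k + i) * (suc k C i) ≡ lucasBinom (suc k + i) i * suc k
  *-lucasBinom k zero    = *-identityʳ (suc k + 0)
  *-lucasBinom k (suc j) = begin
      (suc k + suc j) * a         ≡⟨ *-distribʳ-+ a (suc k) (suc j) ⟩
      suc k * a + suc j * a       ≡⟨ cong (suc k * a +_) ([1+j]*[1+k]C[1+j]≡[1+k]*kCj k j) ⟩
      suc k * a + suc k * (k C j) ≡⟨ *-distribˡ-+ (suc k) a (k C j) ⟨
      suc k * (a + k C j)         ≡⟨ *-comm (suc k) (a + k C j) ⟩
      (a + k C j) * suc k         ≡⟨ cong (_* suc k) (lucasBinom-+ k j) ⟨
      lucasBinom (suc k + suc j) (suc j) * suc k ∎
    where a = suc k C suc j

  lucasCoeff≡lucasBinom : ∀ {n i} → i < n → lucasCoeff n i ≡ lucasBinom n i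
  lucasCoeff≡lucasBinom {n} {i} i<n = subst (λ m → lucasCoeff m i ≡ lucasBinom m i) n′+i≡n (shifted (n ∸ suc i))
    where
      n′+i≡n : suc (n ∸ suc i) + i ≡ n
      n′+i≡n = trans (cong (_+ i) (sym (+-∸-assoc 1 i<n))) (m∸n+n≡m (<⇒≤ i<n))
      shifted : ∀ k → lucasCoeff (suc k + i) i ≡ lucasBinom (suc k + i) i
      shifted k = begin
        lucasCoeff (suc k + i) i
          ≡⟨ cong (λ d → ((suc k + i) * (d C i)) div d) (m+n∸n≡m (suc k) i) ⟩
        (suc k + i) * (suc k C i) / suc k
          ≡⟨ cong (_/ suc k) (*-lucasBinom k i) ⟩
        lucasBinom (suc k + i) i * suc k / suc k
          ≡⟨ m*n/n≡m (lucasBinom (suc k + i) i) (suc k) ⟩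
        lucasBinom (suc k + i) i ∎

  lucasBinom-pascal : ∀ {n j} → j < n → lucasBinom (2 + n) (suc j) ≡ lucasBinom (suc n) (suc j) + lucasBinom n j
  lucasBinom-pascal {n} {zero} _ = begin
      suc n C 1 + 1   ≡⟨ cong (_+ 1) (nC1≡n (suc n)) ⟩
      suc n + 1       ≡⟨ cong (λ m → suc m + 1) (nC1≡n n) ⟨
      suc (n C 1) + 1 ≡⟨ cong (_+ 1) (+-comm 1 (n C 1)) ⟩
      n C 1 + 1 + 1   ∎
  lucasBinom-pascal {n} {suc i} 2+i≤n = begin
      (n ∸ i) C (2 + i) + (n ∸ suc i) C suc i
        ≡⟨ cong₂ (λ b c → b C (2 + i) + c C suc i) (trans n∸i≡1+[n∸1+i] (cong suc n∸1+i≡1+a)) n∸1+i≡1+a ⟩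
      (2 + a) C (2 + i) + suc a C suc i
        ≡⟨ cong₂ _+_ (nCk+nC[k+1]≡[n+1]C[k+1] (suc a) (suc i)) (nCk+nC[k+1]≡[n+1]C[k+1] a i) ⟨
      (suc a C suc i + suc a C (2 + i)) + (a C i + a C suc i)
        ≡⟨ rearrange (suc a C suc i) (suc a C (2 + i)) (a C i) (a C suc i) ⟩
      (suc a C (2 + i) + a C suc i) + (suc a C suc i + a C i)
        ≡⟨ cong (λ b → (b C (2 + i) + a C suc i) + (b C suc i + a C i)) n∸1+i≡1+a ⟨
      lucasBinom (suc n) (2 + i) + lucasBinom n (suc i) ∎
    where
      a = n ∸ (2 + i)
      n∸i≡1+[n∸1+i] : n ∸ i ≡ suc (n ∸ suc i)
      n∸i≡1+[n∸1+i] = +-∸-assoc 1 (<⇒≤ 2+i≤n)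
      n∸1+i≡1+a : n ∸ suc i ≡ suc a
      n∸1+i≡1+a = +-∸-assoc 1 2+i≤n
      rearrange : ∀ x y p q → (x + y) + (p + q) ≡ (y + q) + (x + p)
      rearrange = solve-∀

module _ {c ℓ : Level} (R : CommutativeRing c ℓ) where

  open CommutativeRing R
  open import Algebra.Bundles using (Semiring)
  open import Algebra.Definitions.RawSemiring (Semiring.rawSemiring semiring) using (_×_; _^_)
  open import Algebra.Properties.Semiring.Mult semiring using (×-comm-*)
  open import Algebra.Properties.Monoid.Mult +-monoid using (×-homo-+; ×-homo-1)
  open import Algebra.Properties.CommutativeSemigroup +-commutativeSemigroup using (interchange; x∙yz≈y∙xz)
  open import Algebra.Properties.CommutativeSemigroup *-commutativeSemigroup using () renaming (x∙yz≈y∙xz to x*yz≈y*xz)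
  open import Data.Nat.Properties
    using (≤-refl; ≤-trans; ≤-<-trans; <⇒≤; n≤1+n; n<1+n; m≤n⇒m≤1+n; m≤n*m; +-monoʳ-≤; +-mono-≤; *-monoʳ-≤; +-suc; *-suc; +-∸-assoc)
  open import Data.Nat.Combinatorics using (k>n⇒nCk≡0; nCk+nC[k+1]≡[n+1]C[k+1])
  open import Relation.Binary.PropositionalEquality as ≡ using (_≡_; cong; cong₂)
  open import Relation.Binary.Reasoning.Setoid setoid
  open import Data.Nat.Tactic.RingSolver using (solve-∀)
  open LucasCoefficients using (lucasBinom; lucasCoeff≡lucasBinom; lucasBinom-pascal)

  sumTo-cong : ∀ m {f g : ℕ → Carrier} → (∀ i → i ≤ m → f i ≈ g i) → sumTo R m f ≈ sumTo R m g
  sumTo-cong zero    f≈g = f≈g 0 ℕ.z≤n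
  sumTo-cong (suc m) f≈g = +-cong (sumTo-cong m (λ i i≤m → f≈g i (m≤n⇒m≤1+n i≤m))) (f≈g (suc m) ≤-refl)

  *-distribˡ-sumTo : ∀ x m (f : ℕ → Carrier) → x * sumTo R m f ≈ sumTo R m (λ i → x * f i)
  *-distribˡ-sumTo x zero    f = refl
  *-distribˡ-sumTo x (suc m) f = trans (distribˡ x _ _) (+-congʳ (*-distribˡ-sumTo x m f))

  sumTo-suc-split : ∀ m {f g k : ℕ → Carrier} → f 0 ≈ k 0 → (∀ i → i ≤ m → f (suc i) ≈ g i + k (suc i)) →
                    sumTo R (suc m) f ≈ sumTo R m g + sumTo R (suc m) k
  sumTo-suc-split zero    {f} {g} {k} f₀≈k₀ f≈g+k = begin
    f 0 + f 1           ≈⟨ +-cong f₀≈k₀ (f≈g+k 0 ℕ.z≤n) ⟩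
    k 0 + (g 0 + k 1)   ≈⟨ x∙yz≈y∙xz (k 0) (g 0) (k 1) ⟩
    g 0 + (k 0 + k 1)   ∎
  sumTo-suc-split (suc m) {f} {g} {k} f₀≈k₀ f≈g+k = begin
    sumTo R (suc m) f + f (2 ℕ.+ m)
      ≈⟨ +-cong (sumTo-suc-split m f₀≈k₀ (λ i i≤m → f≈g+k i (m≤n⇒m≤1+n i≤m))) (f≈g+k (suc m) ≤-refl) ⟩
    (sumTo R m g + sumTo R (suc m) k) + (g (suc m) + k (2 ℕ.+ m))
      ≈⟨ interchange _ _ _ _ ⟩
    sumTo R (suc m) g + sumTo R (2 ℕ.+ m) k ∎

  binomialSum : Carrier → ℕ → (ℕ → Carrier) → Carrier
  binomialSum x s a = sumTo R s (λ i → ((s C i) × a i) * x ^ i)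

  binomialSum-suc : ∀ x s a → binomialSum x (suc s) a ≈ binomialSum x s a + x * binomialSum x s (λ i → a (suc i))
  binomialSum-suc x s a = begin
    binomialSum x (suc s) a
      ≈⟨ sumTo-suc-split s refl (λ i _ → pascal i) ⟩
    sumTo R s (λ i → x * term (λ j → a (suc j)) i) + (binomialSum x s a + term a (suc s))
      ≈⟨ +-congˡ (trans (+-congˡ top-vanishes) (+-identityʳ _)) ⟩
    sumTo R s (λ i → x * term (λ j → a (suc j)) i) + binomialSum x s a
      ≈⟨ +-comm _ _ ⟩
    binomialSum x s a + sumTo R s (λ i → x * term (λ j → a (suc j)) i)
      ≈⟨ +-congˡ (*-distribˡ-sumTo x s _) ⟨
    binomialSum x s a + x * binomialSum x s (λ i → a (suc i)) ∎
    where
      term : (ℕ → Carrier) → ℕ → Carrier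
      term b i = ((s C i) × b i) * x ^ i
      top-vanishes : term a (suc s) ≈ 0#
      top-vanishes = trans (*-congʳ (reflexive (cong (_× a (suc s)) (k>n⇒nCk≡0 (n<1+n s))))) (zeroˡ _)
      pascal : ∀ i → ((suc s C suc i) × a (suc i)) * x ^ suc i ≈ x * term (λ j → a (suc j)) i + term a (suc i)
      pascal i = begin
        ((suc s C suc i) × a (suc i)) * x ^ suc i
          ≈⟨ *-congʳ (reflexive (cong (_× a (suc i)) (nCk+nC[k+1]≡[n+1]C[k+1] s i))) ⟨
        (((s C i) ℕ.+ (s C suc i)) × a (suc i)) * x ^ suc i
          ≈⟨ trans (*-congʳ (×-homo-+ (a (suc i)) (s C i) (s C suc i))) (distribʳ _ _ _) ⟩
        ((s C i) × a (suc i)) * (x * x ^ i) + term a (suc i)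
          ≈⟨ +-congʳ (x*yz≈y*xz _ x _) ⟩
        x * term (λ j → a (suc j)) i + term a (suc i) ∎

  lucasTerm : Carrier → ℕ → ℕ → Carrier
  lucasTerm h n i = lucasBinom n i × h ^ (n ∸ 2 ℕ.* i)

  incLucas≈sumTo-lucasTerm : ∀ h {n l} → l < n → incLucas R h n l ≈ sumTo R l (lucasTerm h n)
  incLucas≈sumTo-lucasTerm h {n} {l} l<n = sumTo-cong l (λ i i≤l →
    reflexive (cong (_× h ^ (n ∸ 2 ℕ.* i)) (lucasCoeff≡lucasBinom (≤-<-trans i≤l l<n))))

  lucasTerm-pascal : ∀ h {n j} → 2 ℕ.* j < n → lucasTerm h (2 ℕ.+ n) (suc j) ≈ lucasTerm h n j + h * lucasTerm h (suc n) (suc j)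
  lucasTerm-pascal h {n} {j} 2j<n = begin
    lucasBinom (2 ℕ.+ n) (suc j) × h ^ (2 ℕ.+ n ∸ 2 ℕ.* suc j)
      ≈⟨ reflexive (cong₂ _×_ (lucasBinom-pascal j<n) (cong (λ e → h ^ (2 ℕ.+ n ∸ e)) (*-suc 2 j))) ⟩
    (lucasBinom (suc n) (suc j) ℕ.+ lucasBinom n j) × h ^ (n ∸ 2 ℕ.* j)
      ≈⟨ trans (×-homo-+ _ (lucasBinom (suc n) (suc j)) (lucasBinom n j)) (+-comm _ _) ⟩
    lucasTerm h n j + lucasBinom (suc n) (suc j) × h ^ (n ∸ 2 ℕ.* j)
      ≈⟨ +-congˡ (reflexive (cong (λ e → lucasBinom (suc n) (suc j) × h ^ e) 1+[1+n∸2+2j]≡n∸2j)) ⟨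
    lucasTerm h n j + lucasBinom (suc n) (suc j) × (h * h ^ (suc n ∸ 2 ℕ.* suc j))
      ≈⟨ +-congˡ (×-comm-* (lucasBinom (suc n) (suc j)) h _) ⟨
    lucasTerm h n j + h * lucasTerm h (suc n) (suc j) ∎
    where
      j<n : j < n
      j<n = ≤-<-trans (m≤n*m j 2) 2j<n
      1+[1+n∸2+2j]≡n∸2j : suc (suc n ∸ 2 ℕ.* suc j) ≡ n ∸ 2 ℕ.* j
      1+[1+n∸2+2j]≡n∸2j = ≡.trans (cong (λ e → suc (suc n ∸ e)) (*-suc 2 j)) (≡.sym (+-∸-assoc 1 2j<n))

  incLucas-recurrence : ∀ h n l → 2 ℕ.* l < n →
                        incLucas R h (2 ℕ.+ n) (suc l) ≈ h * incLucas R h (suc n) (suc l) + incLucas R h n l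
  incLucas-recurrence h n l 2l<n = begin
    incLucas R h (2 ℕ.+ n) (suc l)
      ≈⟨ incLucas≈sumTo-lucasTerm h (ℕ.s≤s (ℕ.s≤s l≤n)) ⟩
    sumTo R (suc l) (lucasTerm h (2 ℕ.+ n))
      ≈⟨ sumTo-suc-split l (sym (×-comm-* 1 h _)) (λ j j≤l → lucasTerm-pascal h {n} {j} (≤-<-trans (*-monoʳ-≤ 2 j≤l) 2l<n)) ⟩
    sumTo R l (lucasTerm h n) + sumTo R (suc l) (λ i → h * lucasTerm h (suc n) i)
      ≈⟨ +-congˡ (*-distribˡ-sumTo h (suc l) _) ⟨
    sumTo R l (lucasTerm h n) + h * sumTo R (suc l) (lucasTerm h (suc n))
      ≈⟨ +-cong (incLucas≈sumTo-lucasTerm h l<n) (*-congˡ (incLucas≈sumTo-lucasTerm h (ℕ.s≤s l<n))) ⟨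
    incLucas R h n l + h * incLucas R h (suc n) (suc l)
      ≈⟨ +-comm _ _ ⟩
    h * incLucas R h (suc n) (suc l) + incLucas R h n l ∎
    where
      l<n : l < n
      l<n = ≤-<-trans (m≤n*m l 2) 2l<n
      l≤n : l ≤ n
      l≤n = <⇒≤ l<n

  binomialSum-incLucas : ∀ h s n l → 2 ℕ.* l ℕ.+ s ≤ n →
                         binomialSum h s (λ i → incLucas R h (n ℕ.+ i) (l ℕ.+ i)) ≈ incLucas R h (n ℕ.+ 2 ℕ.* s) (l ℕ.+ s)
  binomialSum-incLucas h zero    n l _   = trans (*-identityʳ _) (×-homo-1 _)
  binomialSum-incLucas h (suc s) n l 2l+1+s≤n = begin
    binomialSum h (suc s) (λ i → L (n ℕ.+ i) (l ℕ.+ i))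
      ≈⟨ binomialSum-suc h s _ ⟩
    binomialSum h s (λ i → L (n ℕ.+ i) (l ℕ.+ i)) + h * binomialSum h s (λ i → L (n ℕ.+ suc i) (l ℕ.+ suc i))
      ≈⟨ +-congˡ (*-congˡ (sumTo-cong s (λ i _ → *-congʳ (reflexive (cong ((s C i) ×_) (cong₂ L (+-suc n i) (+-suc l i))))))) ⟩
    binomialSum h s (λ i → L (n ℕ.+ i) (l ℕ.+ i)) + h * binomialSum h s (λ i → L (suc n ℕ.+ i) (suc l ℕ.+ i))
      ≈⟨ +-cong (binomialSum-incLucas h s n l 2l+s≤n) (*-congˡ (binomialSum-incLucas h s (suc n) (suc l) 2[1+l]+s≤1+n)) ⟩
    L (n ℕ.+ 2 ℕ.* s) (l ℕ.+ s) + h * L (suc n ℕ.+ 2 ℕ.* s) (suc l ℕ.+ s)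
      ≈⟨ +-comm _ _ ⟩
    h * L (suc (n ℕ.+ 2 ℕ.* s)) (suc (l ℕ.+ s)) + L (n ℕ.+ 2 ℕ.* s) (l ℕ.+ s)
      ≈⟨ incLucas-recurrence h (n ℕ.+ 2 ℕ.* s) (l ℕ.+ s) 2[l+s]<n+2s ⟨
    L (2 ℕ.+ (n ℕ.+ 2 ℕ.* s)) (suc (l ℕ.+ s))
      ≈⟨ reflexive (cong₂ L (2+[n+2s]≡n+2[1+s] n s) (≡.sym (+-suc l s))) ⟩
    L (n ℕ.+ 2 ℕ.* suc s) (l ℕ.+ suc s) ∎
    where
      L : ℕ → ℕ → Carrier
      L = incLucas R h
      2[1+l]+s≡1+[2l+1+s] : ∀ l s → 2 ℕ.* suc l ℕ.+ s ≡ suc (2 ℕ.* l ℕ.+ suc s)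
      2[1+l]+s≡1+[2l+1+s] = solve-∀
      2l+1+s+s≡1+2[l+s] : ∀ l s → 2 ℕ.* l ℕ.+ suc s ℕ.+ s ≡ suc (2 ℕ.* (l ℕ.+ s))
      2l+1+s+s≡1+2[l+s] = solve-∀
      2+[n+2s]≡n+2[1+s] : ∀ n s → 2 ℕ.+ (n ℕ.+ 2 ℕ.* s) ≡ n ℕ.+ 2 ℕ.* suc s
      2+[n+2s]≡n+2[1+s] = solve-∀
      2l+s≤n : 2 ℕ.* l ℕ.+ s ≤ n
      2l+s≤n = ≤-trans (+-monoʳ-≤ (2 ℕ.* l) (n≤1+n s)) 2l+1+s≤n
      2[1+l]+s≤1+n : 2 ℕ.* suc l ℕ.+ s ≤ suc n
      2[1+l]+s≤1+n = ≡.subst (_≤ suc n) (≡.sym (2[1+l]+s≡1+[2l+1+s] l s)) (ℕ.s≤s 2l+1+s≤n)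
      2[l+s]<n+2s : 2 ℕ.* (l ℕ.+ s) < n ℕ.+ 2 ℕ.* s
      2[l+s]<n+2s = ≡.subst (_≤ n ℕ.+ 2 ℕ.* s) (2l+1+s+s≡1+2[l+s] l s) (+-mono-≤ 2l+1+s≤n (m≤n*m s 2))

proposition12 : {c ℓ : Level} (R : CommutativeRing c ℓ) (h : CommutativeRing.Carrier R) (s n l : ℕ) →
    1 ≤ n → 2 ℕ.* l ℕ.+ s ≤ n →
    CommutativeRing._≈_ R
      (sumTo R s (λ i → CommutativeRing._*_ R (nmul R (s C i) (incLucas R h (n ℕ.+ i) (l ℕ.+ i))) (pow R h i)))
      (incLucas R h (n ℕ.+ 2 ℕ.* s) (l ℕ.+ s))
-- 1 ≤ n is not needed: for n = 0 both sides are the junk value incLucas R h 0 0.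
proposition12 R h s n l _ = binomialSum-incLucas R h s n l
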